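{- Let $A$ be an oracle and suppose there is a total computable function $g$ such that for every $f\le_T A$ there is an infinite c.e. set $D$ and a $(D,g)$-trace tracing $f$. Then $A$ is of hyperimmune-free degree and $A$ is not DNR.
   Context: Given an infinite computably enumerable set $D\subseteq\omega$ and a computable function $g$ dominating the identity with $D\subseteq\mathrm{dom}(g)$, a $(D,g)$-trace is a partial computable function $\sigma$ from $D$ to finite subsets of $\omega$ with $|\sigma(n)|<g(n)$ for all $n\in D$; it traces $f:\omega\to\omega$ if $f(n)\in\sigma(n)$ for all but finitely many $n\in D$. $A$ is of hyperimmune-free degree if every $f\le_T A$ is dominated by a computable function. $A$ is DNR if it computes a function $h$ with $h(e)\neq\varphi_e(e)$ whenever $\varphi_e(e)$ converges, where $\varphi_e$ is the $e$-th partial computable function. -}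

module Defs where

open import Data.Nat using (ℕ; zero; suc; _+_; _*_; _≤_; _<_; _^_; _/_; _%_; _≡ᵇ_)
open import Data.Bool using (Bool; true; false; if_then_else_)
open import Data.Product using (Σ; _×_; _,_; proj₁; proj₂; ∃; ∃-syntax)
open import Data.List using (List; length; filter; upTo)
open import Relation.Binary.PropositionalEquality using (_≡_; _≢_)
open import Relation.Nullary using (¬_)
open import Relation.Nullary.Decidable using (does)
open import Data.Bool.Properties using (T?)
open import Data.Bool using (T)

tri : ℕ → ℕ
tri zero    = zero
tri (suc s) = suc s + tri s

pair : ℕ → ℕ → ℕ
pair a b = tri (a + b) + b

-- inverse of pair, computed by walking the diagonals
unpair : ℕ → ℕ × ℕ
unpair zero = 0 , 0
unpair (suc n) with unpair n
... | zero  , b = suc b , 0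
... | suc a , b = a , suc b

data Code : Set where
  zero′ succ ident left right oracle : Code
  pairC comp prec : Code → Code → Code
  rfind : Code → Code

Oracle : Set
Oracle = ℕ → ℕ

data Eval (O : Oracle) : Code → ℕ → ℕ → Set where
  ev-zero   : ∀ n → Eval O zero′ n 0
  ev-succ   : ∀ n → Eval O succ n (suc n)
  ev-ident  : ∀ n → Eval O ident n n
  ev-left   : ∀ n → Eval O left n (proj₁ (unpair n))
  ev-right  : ∀ n → Eval O right n (proj₂ (unpair n))
  ev-oracle : ∀ n → Eval O oracle n (O n)
  ev-pair   : ∀ {c d n a b} → Eval O c n a → Eval O d n b → Eval O (pairC c d) n (pair a b)
  -- comp c d = c ∘ d
  ev-comp   : ∀ {c d n m k} → Eval O d n m → Eval O c m k → Eval O (comp c d) n k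
  -- prec c d on ⟨a , m⟩ : primitive recursion on m
  ev-prec0  : ∀ {c d a r} → Eval O c a r → Eval O (prec c d) (pair a 0) r
  ev-precS  : ∀ {c d a m i r} → Eval O (prec c d) (pair a m) i →
              Eval O d (pair a (pair m i)) r → Eval O (prec c d) (pair a (suc m)) r
  ev-rfind  : ∀ {c a k} → Eval O c (pair a k) 0 →
              (∀ j → j < k → Σ ℕ λ v → v ≢ 0 × Eval O c (pair a j) v) →
              Eval O (rfind c) a k

-- Gödel numbering: e ↦ code (decoding with fuel; fuel e suffices)

decodeF : ℕ → ℕ → Code
decodeF zero    n = zero′
decodeF (suc f) n = go (n % 10)
  where
  k = n / 10
  a = proj₁ (unpair k)
  b = proj₂ (unpair k)
  go : ℕ → Code
  go 0 = zero′
  go 1 = succ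
  go 2 = ident
  go 3 = left
  go 4 = right
  go 5 = oracle
  go 6 = pairC (decodeF f a) (decodeF f b)
  go 7 = comp (decodeF f a) (decodeF f b)
  go 8 = prec (decodeF f a) (decodeF f b)
  go _ = rfind (decodeF f k)

decode : ℕ → Code
decode e = decodeF e e

χ : (ℕ → Bool) → Oracle
χ A n = if A n then 1 else 0

-- the empty oracle: computations relative to it are plain computations
∅ : Oracle
∅ _ = 0

_≤T_ : (ℕ → ℕ) → (ℕ → Bool) → Set
f ≤T A = Σ Code λ c → ∀ n → Eval (χ A) c n (f n)

Computable : (ℕ → ℕ) → Set
Computable f = Σ Code λ c → ∀ n → Eval ∅ c n (f n)

φ : ℕ → ℕ → ℕ → Set
φ e x y = Eval ∅ (decode e) x y

-- the c.e. set W coded by c : the domain of the partial computable function c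
W : Code → ℕ → Set
W c n = Σ ℕ λ y → Eval ∅ c n y

Infinite : (ℕ → Set) → Set
Infinite D = ∀ m → Σ ℕ λ n → m ≤ n × D n

Dominates : (ℕ → ℕ) → (ℕ → ℕ) → Set
Dominates h f = Σ ℕ λ N → ∀ n → N ≤ n → f n ≤ h n

-- Finite sets via canonical (strong) indices: D_s = { i | bit i of s is 1 }

bit : ℕ → ℕ → ℕ
bit zero    s = s % 2
bit (suc i) s = bit i (s / 2)

_∈ᶠ_ : ℕ → ℕ → Set
i ∈ᶠ s = bit i s ≡ 1

-- |D_s| (all bits of s at positions ≥ s vanish)
card : ℕ → ℕ
card s = length (filter (λ i → T? (bit i s ≡ᵇ 1)) (upTo s))

IsTrace : Code → (ℕ → ℕ) → Code → Set
IsTrace d g σ = ∀ n → W d n → Σ ℕ λ s → Eval ∅ σ n s × card s < g n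

Traces : Code → Code → (ℕ → ℕ) → Set
Traces d σ f = Σ ℕ λ N → ∀ n → N ≤ n → W d n → ∀ s → Eval ∅ σ n s → f n ∈ᶠ s

HyperimmuneFree : (ℕ → Bool) → Set
HyperimmuneFree A = ∀ f → f ≤T A → Σ (ℕ → ℕ) λ h → Computable h × Dominates h f

DNR : (ℕ → Bool) → Set
DNR A = Σ (ℕ → ℕ) λ h → h ≤T A × (∀ e y → φ e e y → h e ≢ y)

-- Proposition 10: if g is computable and every f ≤T A has a (D , g)-trace
-- on some infinite c.e. set D, then A is hyperimmune-free and not DNR.
--
-- Hyperimmune-free: trace the partial sums F of f.  Searching for n ≥ m in D
-- where the trace halts with canonical index s gives a computable h with
-- f m ≤ F n < s = h m, since the elements of D_s lie below s.
-- Not DNR: from a DNR h ≤T A build f ≤T A whose value at n lists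
-- h (index ⟨n , ⟨j , i⟩⟩) for j ≤ n, i < g n; program index ⟨n , ⟨j , i⟩⟩ runs
-- trace number j at n, picks the element of rank i of that finite set and
-- outputs its (j , i)-component.  If σ traced f, then for large n ∈ D the rank
-- i of f n in σ(n) is below g n, and index ⟨n , ⟨encode σ , i⟩⟩ on itself
-- outputs h of itself, contradicting DNR.

module Submission where

open import Defs
open import Data.Nat
open import Data.Nat.Properties
open import Data.Product using (Σ; _×_; _,_; proj₁; proj₂)
open import Data.Sum using (inj₁; inj₂)
open import Data.Empty using (⊥-elim)
open import Data.Nat.DivMod
  using (_/_; _%_; m/n≡1+[m∸n]/n; %-remove-+ˡ; m%n<n; m/n*n≤m; [m+kn]%n≡m%n; m<n⇒m%n≡m;
         +-distrib-/; m<n⇒m/n≡0; m*n/n≡m)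
open import Data.Nat.Divisibility using (n∣n)
open import Data.Nat.GeneralisedArithmetic using (fold; iterate; iterate-is-fold)
open import Data.List using ([]; _∷_; _++_; length; filter; upTo)
open import Data.List.Properties using (applyUpTo-∷ʳ; filter-++; length-++)
open import Data.Bool.Properties using (T?)
open import Relation.Binary.Definitions using (tri<; tri≈; tri>)
open import Relation.Nullary using (yes; no; ¬_)
open import Data.Bool using (Bool; T)
open import Relation.Unary using (Decidable)
open import Relation.Binary.PropositionalEquality

L R : ℕ → ℕ
L n = proj₁ (unpair n)
R n = proj₂ (unpair n)

-- `pair` along a diagonal; these mirror the two clauses of `unpair`.
pair-suc-zero : ∀ b → pair (suc b) 0 ≡ suc (pair 0 b)
pair-suc-zero b rewrite +-identityʳ b | +-identityʳ (b + tri b) = cong suc (+-comm b (tri b))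

pair-suc : ∀ a b → pair a (suc b) ≡ suc (pair (suc a) b)
pair-suc a b = begin
    tri (a + suc b) + suc b   ≡⟨ cong (λ x → tri x + suc b) (+-suc a b) ⟩
    tri (suc a + b) + suc b   ≡⟨ +-suc (tri (suc a + b)) b ⟩
    suc (tri (suc a + b) + b) ∎
  where open ≡-Reasoning

pair-unpair : ∀ n → pair (L n) (R n) ≡ n
pair-unpair zero = refl
pair-unpair (suc n) with unpair n | pair-unpair n
... | zero  , b | e = trans (pair-suc-zero b) (cong suc e)
... | suc a , b | e = trans (pair-suc a b) (cong suc e)

unpair-pair : ∀ a b → unpair (pair a b) ≡ (a , b)
unpair-pair a b = go (pair a b) a b refl
  where
    go : ∀ n a b → pair a b ≡ n → unpair n ≡ (a , b)
    go zero zero zero _ = refl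
    go zero zero (suc b) ()
    go zero (suc a) b ()
    go (suc n) a (suc b) e rewrite go n (suc a) b (suc-injective (trans (sym (pair-suc a b)) e)) = refl
    go (suc n) (suc a) zero e rewrite go n 0 a (suc-injective (trans (sym (pair-suc-zero a)) e)) = refl
    go (suc n) zero zero ()

L-pair : ∀ a b → L (pair a b) ≡ a
L-pair a b = cong proj₁ (unpair-pair a b)

R-pair : ∀ a b → R (pair a b) ≡ b
R-pair a b = cong proj₂ (unpair-pair a b)

+≤pair : ∀ a b → a + b ≤ pair a b
+≤pair a b = ≤-trans (tri≥ (a + b)) (m≤m+n (tri (a + b)) b)
  where
    tri≥ : ∀ n → n ≤ tri n
    tri≥ zero    = z≤n
    tri≥ (suc n) = m≤m+n (suc n) (tri n)

unpair₂ : ∀ (H : ℕ → ℕ → ℕ) a b → H (L (pair a b)) (R (pair a b)) ≡ H a b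
unpair₂ H a b = cong₂ H (L-pair a b) (R-pair a b)

unpair₃ : ∀ (H : ℕ → ℕ → ℕ → ℕ) a b c →
          H (L (pair a (pair b c))) (L (R (pair a (pair b c)))) (R (R (pair a (pair b c)))) ≡ H a b c
unpair₃ H a b c rewrite L-pair a (pair b c) | R-pair a (pair b c) = unpair₂ (H a) b c

Comp : Oracle → (ℕ → ℕ) → Set
Comp O F = Σ Code λ c → ∀ n → Eval O c n (F n)

Comp₂ : Oracle → (ℕ → ℕ → ℕ) → Set
Comp₂ O H = Comp O (λ q → H (L q) (R q))

Comp₃ : Oracle → (ℕ → ℕ → ℕ → ℕ) → Set
Comp₃ O H = Comp O (λ q → H (L q) (L (R q)) (R (R q)))

const-code : ℕ → Code
const-code zero    = zero′
const-code (suc p) = comp succ (const-code p)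

const-code-ok : ∀ {O} p n → Eval O (const-code p) n p
const-code-ok zero    n = ev-zero n
const-code-ok (suc p) n = ev-comp (const-code-ok p n) (ev-succ p)

module _ {O : Oracle} where

  comp-ext : ∀ {F G} → Comp O F → (∀ n → F n ≡ G n) → Comp O G
  comp-ext (c , ok) e = c , λ n → subst (Eval O c n) (e n) (ok n)

  id-comp : Comp O (λ n → n)
  id-comp = ident , ev-ident

  suc-comp : Comp O suc
  suc-comp = succ , ev-succ

  L-comp : Comp O L
  L-comp = left , ev-left

  R-comp : Comp O R
  R-comp = right , ev-right

  pair-comp : ∀ {F G} → Comp O F → Comp O G → Comp O (λ n → pair (F n) (G n))
  pair-comp (c , c-ok) (d , d-ok) = pairC c d , λ n → ev-pair (c-ok n) (d-ok n)

  ∘-comp : ∀ {F G} → Comp O F → Comp O G → Comp O (λ n → F (G n))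
  ∘-comp (c , c-ok) (d , d-ok) = comp c d , λ n → ev-comp (d-ok n) (c-ok _)

  LL-comp : Comp O (λ q → L (L q))
  LL-comp = ∘-comp L-comp L-comp

  LR-comp : Comp O (λ q → L (R q))
  LR-comp = ∘-comp L-comp R-comp

  RL-comp : Comp O (λ q → R (L q))
  RL-comp = ∘-comp R-comp L-comp

  RR-comp : Comp O (λ q → R (R q))
  RR-comp = ∘-comp R-comp R-comp

  const-comp : ∀ k → Comp O (λ _ → k)
  const-comp k = const-code k , const-code-ok k

  app₂ : ∀ {H F G} → Comp₂ O H → Comp O F → Comp O G → Comp O (λ n → H (F n) (G n))
  app₂ {H} {F} {G} h f g = comp-ext (∘-comp h (pair-comp f g)) λ n → unpair₂ H (F n) (G n)

  app₃ : ∀ {H F G K} → Comp₃ O H → Comp O F → Comp O G → Comp O K → Comp O (λ n → H (F n) (G n) (K n))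
  app₃ {H} {F} {G} {K} h f g k =
    comp-ext (∘-comp h (pair-comp f (pair-comp g k))) λ n → unpair₃ H (F n) (G n) (K n)

  rec-comp : ∀ {B S} (H : ℕ → ℕ → ℕ) → Comp O B → Comp₃ O S →
             (∀ a → H a 0 ≡ B a) → (∀ a m → H a (suc m) ≡ S a m (H a m)) → Comp₂ O H
  rec-comp {B} {S} H (b , b-ok) (s , s-ok) base step =
      prec b s , λ n → subst (λ x → Eval O (prec b s) x (H (L n) (R n))) (pair-unpair n) (go (L n) (R n))
    where
      go : ∀ a m → Eval O (prec b s) (pair a m) (H a m)
      go a zero    = subst (Eval O _ _) (sym (base a)) (ev-prec0 (b-ok a))
      go a (suc m) = subst (Eval O _ _) (sym (step a m))
        (ev-precS {a = a} {m = m} (go a m) (subst (Eval O s _) (unpair₃ S a m (H a m)) (s-ok _)))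

  rec₁-comp : ∀ {S} (H : ℕ → ℕ) → Comp₂ O S → (∀ m → H (suc m) ≡ S m (H m)) → Comp O H
  rec₁-comp {S} H s step =
    app₂ {H = λ _ m → H m}
         (rec-comp {S = λ _ m r → S m r} (λ _ m → H m) (const-comp (H 0)) (∘-comp s R-comp) (λ _ → refl) (λ _ → step))
         (const-comp 0) id-comp

  +-comp : Comp₂ O _+_
  +-comp = rec-comp {S = λ _ _ r → suc r} _+_ id-comp (∘-comp suc-comp RR-comp) +-identityʳ +-suc

  *-comp : Comp₂ O _*_
  *-comp = rec-comp {S = λ a _ r → a + r} _*_ (const-comp 0) (app₂ {H = _+_} +-comp L-comp RR-comp) *-zeroʳ *-suc

  pred-comp : Comp O pred
  pred-comp = rec₁-comp {S = λ m _ → m} pred L-comp (λ _ → refl)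

  ∸-comp : Comp₂ O _∸_
  ∸-comp = rec-comp {S = λ _ _ r → pred r} _∸_ id-comp (∘-comp pred-comp RR-comp) (λ _ → refl)
                    (λ a m → sym (pred[m∸n]≡m∸[1+n] a m))

ifz : ℕ → ℕ → ℕ → ℕ
ifz zero    a b = a
ifz (suc _) a b = b

isZero : ℕ → ℕ
isZero x = ifz x 1 0

isZero≡0 : ∀ {x} → isZero x ≡ 0 → Σ ℕ λ y → x ≡ suc y
isZero≡0 {suc y} _ = y , refl

module _ {O : Oracle} where

  -- by recursion on the condition, with the two branches as parameter ⟨a , b⟩
  ifz-comp : ∀ {F G K} → Comp O F → Comp O G → Comp O K → Comp O (λ n → ifz (F n) (G n) (K n))
  ifz-comp = app₃ {H = ifz} (app₂ {H = λ p x → ifz x (L p) (R p)}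
               (rec-comp {S = λ p _ _ → R p} (λ p x → ifz x (L p) (R p)) L-comp RL-comp (λ _ → refl) (λ _ _ → refl))
               R-comp L-comp)

  isZero-comp : ∀ {F} → Comp O F → Comp O (λ n → isZero (F n))
  isZero-comp f = ifz-comp f (const-comp 1) (const-comp 0)

-- Clocked evaluation of unrelativised computations: `run c t n` is 0 while the
-- computation of c on input n has not been seen to halt with clock t, and
-- suc v once it has been seen to halt with output v; the clock bounds the
-- number of candidates each unbounded search inspects.

both : ℕ → ℕ → ℕ
both x y = ifz x 0 (ifz y 0 (suc (pair (pred x) (pred y))))

-- One step of an unbounded search at candidate m with clocked value v:
-- abort (1) if v is undefined, succeed (m + 2) on value 0, continue (0) otherwise.
search-step : ℕ → ℕ → ℕ
search-step v m = ifz v 1 (ifz (pred v) (suc (suc m)) 0)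

mutual
  run : Code → ℕ → ℕ → ℕ
  run zero′       t n = 1
  run succ        t n = suc (suc n)
  run ident       t n = suc n
  run left        t n = suc (L n)
  run right       t n = suc (R n)
  run oracle      t n = 1
  run (pairC c d) t n = both (run c t n) (run d t n)
  run (comp c d)  t n = ifz (run d t n) 0 (run c t (pred (run d t n)))
  run (prec c d)  t n = run-prec c d t (L n) (R n)
  run (rfind c)   t a = pred (search c t a t)

  run-prec : Code → Code → ℕ → ℕ → ℕ → ℕ
  run-prec c d t a zero    = run c t a
  run-prec c d t a (suc m) = ifz (run-prec c d t a m) 0 (run d t (pair a (pair m (pred (run-prec c d t a m)))))

  -- state of the search for a zero of c ⟨a , -⟩ after k candidates:
  -- 0 still searching, 1 aborted, j + 2 found j
  search : Code → ℕ → ℕ → ℕ → ℕ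
  search c t a zero    = 0
  search c t a (suc k) = ifz (search c t a k) (search-step (run c t (pair a k)) k) (search c t a k)

module _ {O : Oracle} where

  both-comp : ∀ {F G} → Comp O F → Comp O G → Comp O (λ n → both (F n) (G n))
  both-comp f g = ifz-comp f (const-comp 0)
    (ifz-comp g (const-comp 0) (∘-comp suc-comp (pair-comp (∘-comp pred-comp f) (∘-comp pred-comp g))))

  search-step-comp : ∀ {F G} → Comp O F → Comp O G → Comp O (λ n → search-step (F n) (G n))
  search-step-comp f g = ifz-comp f (const-comp 1)
    (ifz-comp (∘-comp pred-comp f) (∘-comp suc-comp (∘-comp suc-comp g)) (const-comp 0))

  run-comp : ∀ c → Comp₂ O (run c)
  run-comp zero′       = const-comp 1
  run-comp succ        = ∘-comp suc-comp (∘-comp suc-comp R-comp)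
  run-comp ident       = ∘-comp suc-comp R-comp
  run-comp left        = ∘-comp suc-comp LR-comp
  run-comp right       = ∘-comp suc-comp RR-comp
  run-comp oracle      = const-comp 1
  run-comp (pairC c d) = both-comp (run-comp c) (run-comp d)
  run-comp (comp c d)  = ifz-comp (run-comp d) (const-comp 0)
                           (app₂ {H = run c} (run-comp c) L-comp (∘-comp pred-comp (run-comp d)))
  run-comp (prec c d)  =
      comp-ext (app₂ {H = H} (rec-comp {S = S} H (run-comp c) step (λ _ → refl) (λ _ _ → refl))
                     (pair-comp L-comp LR-comp) RR-comp)
               λ p → unpair₂ (λ t a → run-prec c d t a (R (R p))) (L p) (L (R p))
    where
      H : ℕ → ℕ → ℕ
      H x = run-prec c d (L x) (R x)
      S : ℕ → ℕ → ℕ → ℕ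
      S x m r = ifz r 0 (run d (L x) (pair (R x) (pair m (pred r))))
      step : Comp₃ O S
      step = ifz-comp RR-comp (const-comp 0)
               (app₂ {H = run d} (run-comp d) LL-comp
                 (pair-comp RL-comp (pair-comp LR-comp (∘-comp pred-comp RR-comp))))
  run-comp (rfind c)   =
      ∘-comp pred-comp
        (app₂ {H = H} (rec-comp {S = S} H (const-comp 0) step (λ _ → refl) (λ _ _ → refl)) id-comp L-comp)
    where
      H : ℕ → ℕ → ℕ
      H x = search c (L x) (R x)
      S : ℕ → ℕ → ℕ → ℕ
      S x k r = ifz r (search-step (run c (L x) (pair (R x) k)) k) r
      step : Comp₃ O S
      step = ifz-comp RR-comp
               (search-step-comp (app₂ {H = run c} (run-comp c) LL-comp
                                   (pair-comp RL-comp LR-comp))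
                                 LR-comp)
               RR-comp

Rejected : Code → ℕ → ℕ → ℕ → Set
Rejected c t a j = Σ ℕ λ w → run c t (pair a j) ≡ suc (suc w)

search-running : ∀ c t a k → search c t a k ≡ 0 → ∀ j → j < k → Rejected c t a j
search-running c t a (suc k) e j j<1+k with search c t a k in e₁
search-running c t a (suc k) () j j<1+k | suc _
search-running c t a (suc k) e j j<1+k | zero with run c t (pair a k) in e₂ | m<1+n⇒m<n∨m≡n j<1+k
search-running c t a (suc k) () j j<1+k | zero | zero        | _
search-running c t a (suc k) () j j<1+k | zero | suc zero    | _
search-running c t a (suc k) e j j<1+k  | zero | suc (suc w) | inj₂ refl = w , e₂
search-running c t a (suc k) e j j<1+k  | zero | suc (suc w) | inj₁ j<k  = search-running c t a k e₁ j j<k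

search-found : ∀ c t a k j → search c t a k ≡ suc (suc j) →
               run c t (pair a j) ≡ 1 × (∀ i → i < j → Rejected c t a i)
search-found c t a (suc k) j e with search c t a k in e₁
search-found c t a (suc k) j e | suc x = search-found c t a k j (trans e₁ e)
search-found c t a (suc k) j e | zero with run c t (pair a k) in e₂
search-found c t a (suc k) j () | zero | zero
search-found c t a (suc k) .k refl | zero | suc zero = e₂ , search-running c t a k e₁
search-found c t a (suc k) j () | zero | suc (suc w)

run-sound : ∀ c t n v → run c t n ≡ suc v → Eval ∅ c n v
run-sound zero′ t n .0 refl = ev-zero n
run-sound succ t n .(suc n) refl = ev-succ n
run-sound ident t n .n refl = ev-ident n
run-sound left t n .(L n) refl = ev-left n
run-sound right t n .(R n) refl = ev-right n
run-sound oracle t n .0 refl = ev-oracle n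
run-sound (pairC c d) t n v e with run c t n in e₁ | run d t n in e₂
run-sound (pairC c d) t n v () | zero | _
run-sound (pairC c d) t n v () | suc x | zero
run-sound (pairC c d) t n .(pair x y) refl | suc x | suc y = ev-pair (run-sound c t n x e₁) (run-sound d t n y e₂)
run-sound (comp c d) t n v e with run d t n in e₁
run-sound (comp c d) t n v () | zero
run-sound (comp c d) t n v e | suc m = ev-comp (run-sound d t n m e₁) (run-sound c t m v e)
run-sound (prec c d) t n v e = subst (λ x → Eval ∅ (prec c d) x v) (pair-unpair n) (go (L n) (R n) v e)
  where
    go : ∀ a m v → run-prec c d t a m ≡ suc v → Eval ∅ (prec c d) (pair a m) v
    go a zero v e = ev-prec0 (run-sound c t a v e)
    go a (suc m) v e with run-prec c d t a m in e₁
    go a (suc m) v () | zero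
    go a (suc m) v e | suc i = ev-precS {a = a} {m = m} (go a m i e₁) (run-sound d t (pair a (pair m i)) v e)
run-sound (rfind c) t a v e with search c t a t in e₁
run-sound (rfind c) t a v refl | suc (suc v) with search-found c t a t v e₁
... | found , rejected = ev-rfind (run-sound c t (pair a v) 0 found) λ i i<v →
  let (w , eq) = rejected i i<v in suc w , (λ ()) , run-sound c t (pair a i) (suc w) eq

Eventually : (ℕ → Set) → Set
Eventually P = Σ ℕ λ t₀ → ∀ t → t₀ ≤ t → P t

eventually-map : ∀ {P Q : ℕ → Set} → (∀ t → P t → Q t) → Eventually P → Eventually Q
eventually-map f (t₀ , p) = t₀ , λ t t₀≤t → f t (p t t₀≤t)

eventually-× : ∀ {P Q : ℕ → Set} → Eventually P → Eventually Q → Eventually (λ t → P t × Q t)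
eventually-× (t₁ , p) (t₂ , q) =
  t₁ ⊔ t₂ , λ t le → p t (≤-trans (m≤m⊔n t₁ t₂) le) , q t (≤-trans (m≤n⊔m t₁ t₂) le)

∀<-extend : ∀ {P : ℕ → Set} {b} → (∀ j → j < b → P j) → P b → ∀ j → j < suc b → P j
∀<-extend below at-b j j<1+b with m<1+n⇒m<n∨m≡n j<1+b
... | inj₁ j<b  = below j j<b
... | inj₂ refl = at-b

eventually-∀< : ∀ {P : ℕ → ℕ → Set} k → (∀ j → j < k → Eventually (P j)) →
                Eventually (λ t → ∀ j → j < k → P j t)
eventually-∀< zero    _  = 0 , λ _ _ _ ()
eventually-∀< (suc k) ev =
  eventually-map (λ _ (below , at-k) → ∀<-extend below at-k)
                 (eventually-× (eventually-∀< k (λ j j<k → ev j (m<n⇒m<1+n j<k))) (ev k ≤-refl))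

search-complete : ∀ c t a k → k < t → run c t (pair a k) ≡ 1 → (∀ j → j < k → Rejected c t a j) →
                  search c t a t ≡ suc (suc k)
search-complete c t a k k<t accepted rejected =
    subst (λ x → search c t a x ≡ suc (suc k)) (m∸n+n≡m k<t) (stays (t ∸ suc k))
  where
    running : ∀ m → m ≤ k → search c t a m ≡ 0
    running zero    _     = refl
    running (suc m) m<k with rejected m m<k
    ... | w , eq rewrite running m (<⇒≤ m<k) | eq = refl
    stays : ∀ d → search c t a (d + suc k) ≡ suc (suc k)
    stays zero    rewrite running k ≤-refl | accepted = refl
    stays (suc d) rewrite stays d = refl

nonzero-rejected : ∀ {x v} → v ≢ 0 → x ≡ suc v → Σ ℕ λ w → x ≡ suc (suc w)
nonzero-rejected {v = zero}  v≢0 _  = ⊥-elim (v≢0 refl)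
nonzero-rejected {v = suc w} _   eq = w , eq

run-prec-pair : ∀ c d t a m → run (prec c d) t (pair a m) ≡ run-prec c d t a m
run-prec-pair c d t = unpair₂ (run-prec c d t)

run-complete : ∀ {c n v} → Eval ∅ c n v → Eventually (λ t → run c t n ≡ suc v)
run-complete (ev-zero n)   = 0 , λ _ _ → refl
run-complete (ev-succ n)   = 0 , λ _ _ → refl
run-complete (ev-ident n)  = 0 , λ _ _ → refl
run-complete (ev-left n)   = 0 , λ _ _ → refl
run-complete (ev-right n)  = 0 , λ _ _ → refl
run-complete (ev-oracle n) = 0 , λ _ _ → refl
run-complete (ev-pair e₁ e₂) =
  eventually-map (λ _ (p , q) → cong₂ both p q) (eventually-× (run-complete e₁) (run-complete e₂))
run-complete (ev-comp {c = c} e₁ e₂) =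
  eventually-map (λ t (p , q) → trans (cong (λ x → ifz x 0 (run c t (pred x))) p) q)
                 (eventually-× (run-complete e₁) (run-complete e₂))
run-complete (ev-prec0 {c = c} {d = d} {a = a} e) =
  eventually-map (λ t p → trans (run-prec-pair c d t a 0) p) (run-complete e)
run-complete (ev-precS {c = c} {d = d} {a = a} {m = m} e₁ e₂) =
  eventually-map (λ t (p , q) → trans (run-prec-pair c d t a (suc m))
                    (trans (cong (λ x → ifz x 0 (run d t (pair a (pair m (pred x)))))
                                 (trans (sym (run-prec-pair c d t a m)) p)) q))
                 (eventually-× (run-complete e₁) (run-complete e₂))
run-complete (ev-rfind {c = c} {a = a} {k = k} e h) =
    eventually-map (λ t (accepted , rejected , k<t) → cong pred (search-complete c t a k k<t accepted rejected))
      (eventually-× (run-complete e) (eventually-× (eventually-∀< k rejected-eventually) (suc k , λ _ le → le)))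
  where
    rejected-eventually : ∀ j → j < k → Eventually (λ t → Rejected c t a j)
    rejected-eventually j j<k =
      eventually-map (λ _ → nonzero-rejected (proj₁ (proj₂ (h j j<k)))) (run-complete (proj₂ (proj₂ (h j j<k))))

least-zero : ∀ (P : ℕ → ℕ) k₀ → P k₀ ≡ 0 → Σ ℕ λ k → P k ≡ 0 × (∀ j → j < k → P j ≢ 0)
least-zero P k₀ Pk₀≡0 = scan k₀ 0 (+-identityʳ k₀) (λ _ ())
  where
    scan : ∀ d b → d + b ≡ k₀ → (∀ j → j < b → P j ≢ 0) → Σ ℕ λ k → P k ≡ 0 × (∀ j → j < k → P j ≢ 0)
    scan d b d+b≡k₀ below with P b ≟ 0
    scan d       b d+b≡k₀ below | yes Pb≡0 = b , Pb≡0 , below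
    scan zero    b b≡k₀   below | no Pb≢0  = ⊥-elim (Pb≢0 (subst (λ x → P x ≡ 0) (sym b≡k₀) Pk₀≡0))
    scan (suc d) b d+b≡k₀ below | no Pb≢0  = scan d (suc b) (trans (+-suc d b) d+b≡k₀) (∀<-extend below Pb≢0)

rfind-halts : ∀ {O P} (cP : Comp O P) a k₀ → P (pair a k₀) ≡ 0 →
              Σ ℕ λ k → Eval O (rfind (proj₁ cP)) a k × P (pair a k) ≡ 0
rfind-halts {O} {P} (c , ok) a k₀ zero-at-k₀ with least-zero (λ k → P (pair a k)) k₀ zero-at-k₀
... | k , zero-at-k , nonzero-below =
  k , ev-rfind (subst (Eval O c (pair a k)) zero-at-k (ok _)) (λ j j<k → P (pair a j) , nonzero-below j j<k , ok _)
    , zero-at-k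

iterate-comp : ∀ {O f} → Comp O f → Comp₂ O (λ x i → iterate f x i)
iterate-comp {f = f} cf = comp-ext
  (rec-comp {S = λ _ _ r → f r} (λ x i → fold x f i) id-comp (∘-comp cf RR-comp) (λ _ → refl) (λ _ _ → refl))
  λ q → iterate-is-fold (L q) f (R q)

half-suc : ∀ m → suc m / 2 ≡ m / 2 + m % 2
parity-suc : ∀ m → suc m % 2 ≡ 1 ∸ m % 2

half-2+ : ∀ m → (2 + m) / 2 ≡ suc (m / 2)
half-2+ m = m/n≡1+[m∸n]/n {2 + m} {2} (s≤s (s≤s z≤n))

parity-2+ : ∀ m → (2 + m) % 2 ≡ m % 2
parity-2+ m = %-remove-+ˡ m n∣n

half-suc zero = refl
half-suc (suc zero) = refl
half-suc (suc (suc m)) rewrite half-2+ (suc m) | half-2+ m | parity-2+ m = cong suc (half-suc m)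

parity-suc zero = refl
parity-suc (suc zero) = refl
parity-suc (suc (suc m)) rewrite parity-2+ (suc m) | parity-2+ m = parity-suc m

module _ {O : Oracle} where

  half-parity-comp : Comp O (λ m → pair (m / 2) (m % 2))
  half-parity-comp = rec₁-comp {S = λ _ r → pair (L r + R r) (1 ∸ R r)} (λ m → pair (m / 2) (m % 2))
    (pair-comp (app₂ {H = _+_} +-comp LR-comp RR-comp)
               (app₂ {H = _∸_} ∸-comp (const-comp 1) RR-comp))
    λ m → cong₂ pair (trans (half-suc m) (sym (unpair₂ _+_ (m / 2) (m % 2))))
                     (trans (parity-suc m) (sym (cong (1 ∸_) (R-pair (m / 2) (m % 2)))))

  half-comp : Comp O (_/ 2)
  half-comp = comp-ext (∘-comp L-comp half-parity-comp) λ m → L-pair (m / 2) (m % 2)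

  parity-comp : Comp O (_% 2)
  parity-comp = comp-ext (∘-comp R-comp half-parity-comp) λ m → R-pair (m / 2) (m % 2)

bit-iterate : ∀ i s → bit i s ≡ iterate (_/ 2) s i % 2
bit-iterate zero    s = refl
bit-iterate (suc i) s = bit-iterate i (s / 2)

bit-comp : ∀ {O} → Comp₂ O bit
bit-comp = comp-ext
  (∘-comp parity-comp (app₂ {H = λ s i → iterate (_/ 2) s i} (iterate-comp half-comp) R-comp L-comp))
  λ q → sym (bit-iterate (L q) (R q))

bit≤1 : ∀ i s → bit i s ≤ 1
bit≤1 i s rewrite bit-iterate i s = ≤-pred (m%n<n (iterate (_/ 2) s i) 2)

∈ᶠ⇒< : ∀ i s → i ∈ᶠ s → i < s
∈ᶠ⇒< zero    zero    ()
∈ᶠ⇒< zero    (suc s) _ = s≤s z≤n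
∈ᶠ⇒< (suc i) s i∈s = begin
    suc (suc i)  ≤⟨ s≤s (s≤s (m≤m*n i 2)) ⟩
    suc i * 2    ≤⟨ *-monoˡ-≤ 2 (∈ᶠ⇒< i (s / 2) i∈s) ⟩
    s / 2 * 2    ≤⟨ m/n*n≤m s 2 ⟩
    s            ∎
  where open ≤-Reasoning

rank : ℕ → ℕ → ℕ
rank s zero    = 0
rank s (suc y) = rank s y + bit y s

rank-comp : ∀ {O} → Comp₂ O rank
rank-comp = rec-comp {S = λ s y r → r + bit y s} rank (const-comp 0)
  (app₂ {H = _+_} +-comp RR-comp (app₂ {H = bit} bit-comp LR-comp L-comp))
  (λ _ → refl) (λ _ _ → refl)

-- The cardinality of D_s is the rank of s (all its elements lie below s).
card≡rank : ∀ s → card s ≡ rank s s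
card≡rank s = count s
  where
    P? : Decidable (λ i → T (bit i s ≡ᵇ 1))
    P? i = T? (bit i s ≡ᵇ 1)
    count-one : ∀ y → length (filter P? (y ∷ [])) ≡ bit y s
    count-one y with bit y s | bit≤1 y s
    ... | zero        | _ = refl
    ... | suc zero    | _ = refl
    ... | suc (suc _) | s≤s ()
    count : ∀ y → length (filter P? (upTo y)) ≡ rank s y
    count zero    = refl
    count (suc y) = begin
      length (filter P? (upTo (suc y)))
        ≡⟨ cong (λ l → length (filter P? l)) (sym (applyUpTo-∷ʳ (λ x → x) y)) ⟩
      length (filter P? (upTo y ++ y ∷ []))
        ≡⟨ cong length (filter-++ P? (upTo y) (y ∷ [])) ⟩
      length (filter P? (upTo y) ++ filter P? (y ∷ []))
        ≡⟨ length-++ (filter P? (upTo y)) ⟩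
      length (filter P? (upTo y)) + length (filter P? (y ∷ []))
        ≡⟨ cong₂ _+_ (count y) (count-one y) ⟩
      rank s y + bit y s
        ∎
      where open ≡-Reasoning

rank-mono : ∀ s {y z} → y ≤ z → rank s y ≤ rank s z
rank-mono s {z = zero}  z≤n = ≤-refl
rank-mono s {z = suc z} y≤1+z with m≤n⇒m<n∨m≡n y≤1+z
... | inj₁ y<1+z = ≤-trans (rank-mono s (≤-pred y<1+z)) (m≤m+n _ _)
... | inj₂ refl  = ≤-refl

rank-step : ∀ s y → y ∈ᶠ s → rank s (suc y) ≡ suc (rank s y)
rank-step s y y∈s rewrite y∈s = +-comm (rank s y) 1

rank<card : ∀ s y → y ∈ᶠ s → rank s y < card s
rank<card s y y∈s rewrite card≡rank s = subst (_≤ rank s s) (rank-step s y y∈s) (rank-mono s (∈ᶠ⇒< y s y∈s))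

rank-injective : ∀ s y z → y ∈ᶠ s → z ∈ᶠ s → rank s y ≡ rank s z → y ≡ z
rank-injective s y z y∈s z∈s eq with <-cmp y z
... | tri≈ _ y≡z _ = y≡z
... | tri< y<z _ _ = ⊥-elim (<-irrefl eq (subst (_≤ rank s z) (rank-step s y y∈s) (rank-mono s y<z)))
... | tri> _ _ z<y = ⊥-elim (<-irrefl (sym eq) (subst (_≤ rank s y) (rank-step s z z∈s) (rank-mono s z<y)))

Traceable : (ℕ → ℕ) → (ℕ → ℕ) → Set
Traceable g f = Σ Code λ d → Infinite (W d) × Σ Code λ σ → IsTrace d g σ × Traces d σ f

trace-defined : ∀ {d g σ} → IsTrace d g σ → ∀ n → W d n → Σ ℕ (Eval ∅ σ n)
trace-defined trace n n∈D = let (s , ev , _) = trace n n∈D in s , ev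

wait : Code → Code → ℕ → ℕ → ℕ → ℕ
wait d σ m n t = (m ∸ n) + isZero (run d t n) + isZero (run σ t n)

wait-comp : ∀ d σ → Comp₃ ∅ (wait d σ)
wait-comp d σ =
  app₂ {H = _+_} +-comp
    (app₂ {H = _+_} +-comp (app₂ {H = _∸_} ∸-comp L-comp LR-comp)
                           (isZero-comp (app₂ {H = run d} (run-comp d) RR-comp LR-comp)))
    (isZero-comp (app₂ {H = run σ} (run-comp σ) RR-comp LR-comp))

wait≡0 : ∀ d σ m n t → wait d σ m n t ≡ 0 →
         m ≤ n × Σ ℕ (λ y → run d t n ≡ suc y) × Σ ℕ (λ s → run σ t n ≡ suc s)
wait≡0 d σ m n t w≡0 = m∸n≡0⇒m≤n (m+n≡0⇒m≡0 (m ∸ n) (m+n≡0⇒m≡0 _ w≡0))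
                     , isZero≡0 (m+n≡0⇒n≡0 (m ∸ n) (m+n≡0⇒m≡0 _ w≡0))
                     , isZero≡0 (m+n≡0⇒n≡0 _ w≡0)

wait-zero : ∀ d σ → Infinite (W d) → (∀ n → W d n → Σ ℕ (Eval ∅ σ n)) →
            ∀ m → Σ ℕ λ n → Σ ℕ λ t → wait d σ m n t ≡ 0
wait-zero d σ inf σ-defined m with inf m
... | n , m≤n , n∈D with run-complete (proj₂ n∈D) | run-complete (proj₂ (σ-defined n n∈D))
... | t₁ , d-halts | t₂ , σ-halts =
  n , t₁ ⊔ t₂ , cong₂ _+_ (cong₂ _+_ (m≤n⇒m∸n≡0 m≤n) (cong isZero (d-halts _ (m≤m⊔n t₁ t₂))))
                           (cong isZero (σ-halts _ (m≤n⊔m t₁ t₂)))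

-- If σ is defined on the infinite c.e. set D and traces F there, a computable
-- h bounds (beyond some N) every m by a value F n with n ≥ m: search for an
-- n ≥ m in D on which σ halts and output the index s of σ(n); F n ∈ D_s < s.
traced-bound : ∀ {F} d σ → Infinite (W d) → (∀ n → W d n → Σ ℕ (Eval ∅ σ n)) → Traces d σ F →
               Σ (ℕ → ℕ) λ h → Computable h × Σ ℕ λ N → ∀ m → N ≤ m → Σ ℕ λ n → m ≤ n × F n < h m
traced-bound {F} d σ inf σ-defined (N , traced) =
    h , (comp (proj₁ trace-value-comp) (rfind (proj₁ (wait-comp d σ))) , h-ok) , N , bound
  where
    -- a search result k codes ⟨n , t⟩; its value is σ(n) as seen by clock t
    trace-value : ℕ → ℕ
    trace-value k = pred (run σ (R k) (L k))
    trace-value-comp : Comp ∅ trace-value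
    trace-value-comp = ∘-comp pred-comp (app₂ {H = run σ} (run-comp σ) R-comp L-comp)
    wait-at : ∀ m k → wait d σ (L (pair m k)) (L (R (pair m k))) (R (R (pair m k))) ≡ wait d σ m (L k) (R k)
    wait-at m k rewrite L-pair m k | R-pair m k = refl
    found : ∀ m → Σ ℕ λ k → Eval ∅ (rfind (proj₁ (wait-comp d σ))) m k × wait d σ m (L k) (R k) ≡ 0
    found m =
      let (n , t , w≡0) = wait-zero d σ inf σ-defined m
          (k , ev , wk≡0) = rfind-halts (wait-comp d σ) m (pair n t)
                              (trans (wait-at m (pair n t)) (trans (unpair₂ (wait d σ m) n t) w≡0))
      in k , ev , trans (sym (wait-at m k)) wk≡0
    h : ℕ → ℕ
    h m = trace-value (proj₁ (found m))
    h-ok : ∀ m → Eval ∅ (comp (proj₁ trace-value-comp) (rfind (proj₁ (wait-comp d σ)))) m (h m)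
    h-ok m = ev-comp (proj₁ (proj₂ (found m))) (proj₂ trace-value-comp _)
    bound : ∀ m → N ≤ m → Σ ℕ λ n → m ≤ n × F n < h m
    bound m N≤m with proj₁ (found m) | proj₂ (proj₂ (found m))
    ... | k | w≡0 with wait≡0 d σ m (L k) (R k) w≡0
    ... | m≤n , (y , d-halts) , (s , σ-halts) rewrite σ-halts =
      L k , m≤n , ∈ᶠ⇒< _ s (traced (L k) (≤-trans N≤m m≤n) (y , run-sound d (R k) (L k) y d-halts)
                                    s (run-sound σ (R k) (L k) s σ-halts))

-- F n = f 0 + … + f n : a nondecreasing majorant of f computable from f.
partial-sums : (ℕ → ℕ) → ℕ → ℕ
partial-sums f zero    = f 0
partial-sums f (suc n) = partial-sums f n + f (suc n)

partial-sums-comp : ∀ {O f} → Comp O f → Comp O (partial-sums f)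
partial-sums-comp {f = f} cf = rec₁-comp {S = λ n r → r + f (suc n)} (partial-sums f)
  (app₂ {H = _+_} +-comp R-comp (∘-comp cf (∘-comp suc-comp L-comp))) (λ _ → refl)

partial-sums-≥ : ∀ f {m n} → m ≤ n → f m ≤ partial-sums f n
partial-sums-≥ f {n = zero}  z≤n   = ≤-refl
partial-sums-≥ f {n = suc n} m≤1+n with m≤n⇒m<n∨m≡n m≤1+n
... | inj₁ m<1+n = ≤-trans (partial-sums-≥ f (≤-pred m<1+n)) (m≤m+n _ _)
... | inj₂ refl  = m≤n+m _ _

traceable⇒hyperimmune-free : ∀ A g → (∀ f → f ≤T A → Traceable g f) → HyperimmuneFree A
traceable⇒hyperimmune-free A g traceable f f≤A =
  let (d , inf , σ , trace , traced) = traceable (partial-sums f) (partial-sums-comp f≤A)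
      (h , h-comp , N , bound) = traced-bound {F = partial-sums f} d σ inf (trace-defined trace) traced
  in h , h-comp , N , λ m N≤m →
       let (n , m≤n , Fn<hm) = bound m N≤m in ≤-trans (partial-sums-≥ f m≤n) (<⇒≤ Fn<hm)

-- Gödel numbers of codes: the last decimal digit is the constructor, the
-- remaining digits code the (paired) subcodes; `decode` inverts this.
encode : Code → ℕ
encode zero′       = 0
encode succ        = 1
encode ident       = 2
encode left        = 3
encode right       = 4
encode oracle      = 5
encode (pairC c d) = 6 + pair (encode c) (encode d) * 10
encode (comp c d)  = 7 + pair (encode c) (encode d) * 10
encode (prec c d)  = 8 + pair (encode c) (encode d) * 10
encode (rfind c)   = 9 + encode c * 10

last-digit : ∀ r x → r < 10 → (r + x * 10) % 10 ≡ r
last-digit r x r<10 = trans ([m+kn]%n≡m%n r x 10) (m<n⇒m%n≡m r<10)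

other-digits : ∀ r x → r < 10 → (r + x * 10) / 10 ≡ x
other-digits r x r<10 = trans (+-distrib-/ r (x * 10) no-carry) (cong₂ _+_ (m<n⇒m/n≡0 r<10) (m*n/n≡m x 10))
  where
    no-carry : r % 10 + (x * 10) % 10 < 10
    no-carry rewrite m<n⇒m%n≡m r<10 | last-digit 0 x z<s | +-identityʳ r = r<10

decodeF-pairC : ∀ f a b → decodeF (suc f) (6 + pair a b * 10) ≡ pairC (decodeF f a) (decodeF f b)
decodeF-pairC f a b rewrite last-digit 6 (pair a b) (m<m+n 6 z<s) | other-digits 6 (pair a b) (m<m+n 6 z<s)
                          | unpair-pair a b = refl

decodeF-comp : ∀ f a b → decodeF (suc f) (7 + pair a b * 10) ≡ comp (decodeF f a) (decodeF f b)
decodeF-comp f a b rewrite last-digit 7 (pair a b) (m<m+n 7 z<s) | other-digits 7 (pair a b) (m<m+n 7 z<s)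
                         | unpair-pair a b = refl

decodeF-prec : ∀ f a b → decodeF (suc f) (8 + pair a b * 10) ≡ prec (decodeF f a) (decodeF f b)
decodeF-prec f a b rewrite last-digit 8 (pair a b) (m<m+n 8 z<s) | other-digits 8 (pair a b) (m<m+n 8 z<s)
                         | unpair-pair a b = refl

decodeF-rfind : ∀ f a → decodeF (suc f) (9 + a * 10) ≡ rfind (decodeF f a)
decodeF-rfind f a rewrite last-digit 9 a (m<m+n 9 z<s) | other-digits 9 a (m<m+n 9 z<s) = refl

left≤ : ∀ r a b → a ≤ r + pair a b * 10
left≤ r a b = ≤-trans (m≤m+n a b) (≤-trans (+≤pair a b) (≤-trans (m≤m*n (pair a b) 10) (m≤n+m _ r)))

right≤ : ∀ r a b → b ≤ r + pair a b * 10
right≤ r a b = ≤-trans (m≤n+m b a) (≤-trans (+≤pair a b) (≤-trans (m≤m*n (pair a b) 10) (m≤n+m _ r)))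

decodeF-encode : ∀ c f → encode c ≤ f → decodeF f (encode c) ≡ c
decodeF-encode zero′       zero    _ = refl
decodeF-encode zero′       (suc f) _ = refl
decodeF-encode succ        (suc f) _ = refl
decodeF-encode ident       (suc f) _ = refl
decodeF-encode left        (suc f) _ = refl
decodeF-encode right       (suc f) _ = refl
decodeF-encode oracle      (suc f) _ = refl
decodeF-encode (pairC c d) (suc f) (s≤s le) = trans (decodeF-pairC f (encode c) (encode d))
  (cong₂ pairC (decodeF-encode c f (≤-trans (left≤ 5 _ _) le))
              (decodeF-encode d f (≤-trans (right≤ 5 (encode c) _) le)))
decodeF-encode (comp c d)  (suc f) (s≤s le) = trans (decodeF-comp f (encode c) (encode d))
  (cong₂ comp (decodeF-encode c f (≤-trans (left≤ 6 _ _) le))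
              (decodeF-encode d f (≤-trans (right≤ 6 (encode c) _) le)))
decodeF-encode (prec c d)  (suc f) (s≤s le) = trans (decodeF-prec f (encode c) (encode d))
  (cong₂ prec (decodeF-encode c f (≤-trans (left≤ 7 _ _) le))
              (decodeF-encode d f (≤-trans (right≤ 7 (encode c) _) le)))
decodeF-encode (rfind c)   (suc f) (s≤s le) = trans (decodeF-rfind f (encode c))
  (cong rfind (decodeF-encode c f (≤-trans (≤-trans (m≤m*n (encode c) 10) (m≤n+m _ 8)) le)))

decode-encode : ∀ c → decode (encode c) ≡ c
decode-encode c = decodeF-encode c (encode c) ≤-refl

-- Gödel numbers of compound codes as arithmetic on the numbers of the parts.
-- They are opaque so that numbers of large concrete codes are never unfolded.
opaque
  #comp #pairC : ℕ → ℕ → ℕ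
  #comp  a b = 7 + pair a b * 10
  #pairC a b = 6 + pair a b * 10

  encode-comp : ∀ c d → encode (comp c d) ≡ #comp (encode c) (encode d)
  encode-comp c d = refl

  encode-pairC : ∀ c d → encode (pairC c d) ≡ #pairC (encode c) (encode d)
  encode-pairC c d = refl

  #comp-comp : ∀ {O} → Comp₂ O #comp
  #comp-comp = app₂ {H = _+_} +-comp (const-comp 7)
                 (app₂ {H = _*_} *-comp (pair-comp L-comp R-comp) (const-comp 10))

  #pairC-comp : ∀ {O} → Comp₂ O #pairC
  #pairC-comp = app₂ {H = _+_} +-comp (const-comp 6)
                  (app₂ {H = _*_} *-comp (pair-comp L-comp R-comp) (const-comp 10))

encode-const-comp : ∀ {O} → Comp O (λ p → encode (const-code p))
encode-const-comp = rec₁-comp {S = λ _ r → #comp 1 r} (λ p → encode (const-code p))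
  (app₂ {H = #comp} #comp-comp (const-comp 1) R-comp) (λ p → encode-comp succ (const-code p))

-- Answering every oracle query with 0 turns an unrelativised computation
-- into the same computation relative to any oracle.
unrelativize : Code → Code
unrelativize oracle      = zero′
unrelativize (pairC c d) = pairC (unrelativize c) (unrelativize d)
unrelativize (comp c d)  = comp (unrelativize c) (unrelativize d)
unrelativize (prec c d)  = prec (unrelativize c) (unrelativize d)
unrelativize (rfind c)   = rfind (unrelativize c)
unrelativize c           = c

unrelativize-ok : ∀ {O c n v} → Eval ∅ c n v → Eval O (unrelativize c) n v
unrelativize-ok (ev-zero n)     = ev-zero n
unrelativize-ok (ev-succ n)     = ev-succ n
unrelativize-ok (ev-ident n)    = ev-ident n
unrelativize-ok (ev-left n)     = ev-left n
unrelativize-ok (ev-right n)    = ev-right n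
unrelativize-ok (ev-oracle n)   = ev-zero n
unrelativize-ok (ev-pair e₁ e₂) = ev-pair (unrelativize-ok e₁) (unrelativize-ok e₂)
unrelativize-ok (ev-comp e₁ e₂) = ev-comp (unrelativize-ok e₁) (unrelativize-ok e₂)
unrelativize-ok (ev-prec0 e)    = ev-prec0 (unrelativize-ok e)
unrelativize-ok (ev-precS {a = a} {m = m} e₁ e₂) =
  ev-precS {a = a} {m = m} (unrelativize-ok e₁) (unrelativize-ok e₂)
unrelativize-ok (ev-rfind e below) =
  ev-rfind (unrelativize-ok e) λ j j<k → let (v , v≢0 , ev) = below j j<k in v , v≢0 , unrelativize-ok ev

computable⇒comp : ∀ {O f} → Computable f → Comp O f
computable⇒comp (c , ok) = unrelativize c , λ n → unrelativize-ok (ok n)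

-- tuple F n = ⟨F (n-1) , ⟨… , ⟨F 0 , 0⟩⟩⟩, with component i n recovering F i.
tuple : (ℕ → ℕ) → ℕ → ℕ
tuple F zero    = 0
tuple F (suc n) = pair (F n) (tuple F n)

component : ℕ → ℕ → ℕ → ℕ
component i n x = L (iterate R x (n ∸ suc i))

component-tuple : ∀ F n i → i < n → component i n (tuple F n) ≡ F i
component-tuple F (suc n) i i<1+n with m<1+n⇒m<n∨m≡n i<1+n
... | inj₂ refl rewrite n∸n≡0 i = L-pair (F i) (tuple F i)
... | inj₁ i<n  rewrite +-∸-assoc 1 i<n | R-pair (F n) (tuple F n) = component-tuple F n i i<n

module _ {O : Oracle} where

  component-comp : ∀ {I N X} → Comp O I → Comp O N → Comp O X → Comp O (λ n → component (I n) (N n) (X n))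
  component-comp ci cn cx = ∘-comp L-comp
    (app₂ {H = λ x j → iterate R x j} (iterate-comp R-comp) cx (app₂ {H = _∸_} ∸-comp cn (∘-comp suc-comp ci)))

  tuple-comp : ∀ {F} → Comp₂ O F → Comp₂ O (λ a m → tuple (F a) m)
  tuple-comp {F} cF = rec-comp {S = λ a m r → pair (F a m) r} (λ a m → tuple (F a) m)
    (const-comp 0) (pair-comp (app₂ {H = F} cF L-comp LR-comp) RR-comp)
    (λ _ → refl) (λ _ _ → refl)

differs : ℕ → ℕ → ℕ
differs x y = (x ∸ y) + (y ∸ x)

differs≡0 : ∀ x y → differs x y ≡ 0 → x ≡ y
differs≡0 x y eq = ≤-antisym (m∸n≡0⇒m≤n (m+n≡0⇒m≡0 (x ∸ y) eq)) (m∸n≡0⇒m≤n (m+n≡0⇒n≡0 (x ∸ y) eq))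

select : ℕ → ℕ → ℕ → ℕ
select s i y = differs (bit y s) 1 + differs (rank s y) i

select≡0 : ∀ s i y → select s i y ≡ 0 → y ∈ᶠ s × rank s y ≡ i
select≡0 s i y eq =
  differs≡0 (bit y s) 1 (m+n≡0⇒m≡0 _ eq) , differs≡0 (rank s y) i (m+n≡0⇒n≡0 (differs (bit y s) 1) eq)

select-rank : ∀ s y → y ∈ᶠ s → select s (rank s y) y ≡ 0
select-rank s y y∈s rewrite y∈s | n∸n≡0 (rank s y) = refl

-- For a trace σ, the program with Gödel number
-- index ⟨n , ⟨encode σ , i⟩⟩ computes s = σ(n), searches for the element y of
-- D_s of rank i, and outputs the component at (encode σ , i) of y read as a
-- tuple of tuples.  A DNR function must differ from this output at that index.
module Diagonal (g : ℕ → ℕ) (g-computable : Computable g) where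

  -- stage-3 inputs have the shape ⟨⟨⟨n , ⟨j , i⟩⟩ , s⟩ , y⟩
  selection output : ℕ → ℕ
  selection q = select (R (L q)) (R (R (L (L q)))) (R q)
  output q = component (R (R (L (L q)))) (g (L (L (L q))))
                       (component (L (R (L (L q)))) (suc (L (L (L q)))) (R q))

  stage-input : ℕ → ℕ → ℕ → ℕ → ℕ → ℕ
  stage-input n j i s y = pair (pair (pair n (pair j i)) s) y

  selection-at : ∀ n j i s y → selection (stage-input n j i s y) ≡ select s i y
  selection-at n j i s y rewrite L-pair (pair (pair n (pair j i)) s) y | R-pair (pair (pair n (pair j i)) s) y
                               | L-pair (pair n (pair j i)) s | R-pair (pair n (pair j i)) s
                               | unpair-pair n (pair j i) | unpair-pair j i = refl

  output-at : ∀ n j i s y → output (stage-input n j i s y) ≡ component i (g n) (component j (suc n) y)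
  output-at n j i s y rewrite L-pair (pair (pair n (pair j i)) s) y | R-pair (pair (pair n (pair j i)) s) y
                            | L-pair (pair n (pair j i)) s | unpair-pair n (pair j i) | unpair-pair j i = refl

  -- opaque, so that the (large) codes of these functions are never unfolded
  opaque
    selection-comp : Comp ∅ selection
    selection-comp = app₂ {H = _+_} +-comp
      (differs-comp (app₂ {H = bit} bit-comp R-comp RL-comp) (const-comp 1))
      (differs-comp (app₂ {H = rank} rank-comp RL-comp R-comp)
                    (∘-comp R-comp (∘-comp R-comp LL-comp)))
      where
        differs-comp : ∀ {F G} → Comp ∅ F → Comp ∅ G → Comp ∅ (λ n → differs (F n) (G n))
        differs-comp f g = app₂ {H = _+_} +-comp (app₂ {H = _∸_} ∸-comp f g) (app₂ {H = _∸_} ∸-comp g f)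

    output-comp : Comp ∅ output
    output-comp = component-comp (∘-comp R-comp (∘-comp R-comp LL-comp))
      (∘-comp (computable⇒comp g-computable) (∘-comp L-comp LL-comp))
      (component-comp (∘-comp L-comp (∘-comp R-comp LL-comp))
                      (∘-comp suc-comp (∘-comp L-comp LL-comp)) R-comp)

  chooser : Code
  chooser = pairC ident (rfind (proj₁ selection-comp))

  diagonal-program : Code → Code
  diagonal-program σ = comp (proj₁ output-comp) (comp chooser (pairC ident (comp σ left)))

  diagonal-number : ℕ → ℕ
  diagonal-number x = #comp (encode (proj₁ output-comp)) (#comp (encode chooser) (#pairC 2 (#comp x 3)))

  encode-diagonal : ∀ σ → encode (diagonal-program σ) ≡ diagonal-number (encode σ)
  encode-diagonal σ = begin
    encode (diagonal-program σ)
      ≡⟨ encode-comp (proj₁ output-comp) (comp chooser (pairC ident (comp σ left))) ⟩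
    #comp eo (encode (comp chooser (pairC ident (comp σ left))))
      ≡⟨ cong (#comp eo) (encode-comp chooser (pairC ident (comp σ left))) ⟩
    #comp eo (#comp ec (encode (pairC ident (comp σ left))))
      ≡⟨ cong (λ x → #comp eo (#comp ec x)) (encode-pairC ident (comp σ left)) ⟩
    #comp eo (#comp ec (#pairC 2 (encode (comp σ left))))
      ≡⟨ cong (λ x → #comp eo (#comp ec (#pairC 2 x))) (encode-comp σ left) ⟩
    diagonal-number (encode σ)
      ∎
    where
      open ≡-Reasoning
      eo ec : ℕ
      eo = encode (proj₁ output-comp)
      ec = encode chooser

  -- index p : the Gödel number of the diagonal program for the code numbered
  -- j = L (R p), run on the constant input p.
  index : ℕ → ℕ
  index p = #comp (diagonal-number (L (R p))) (encode (const-code p))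

  index-comp : ∀ {O} → Comp O index
  index-comp = app₂ {H = #comp} #comp-comp
    (app₂ {H = #comp} #comp-comp (const-comp _)
      (app₂ {H = #comp} #comp-comp (const-comp _)
        (app₂ {H = #pairC} #pairC-comp (const-comp 2) (app₂ {H = #comp} #comp-comp LR-comp (const-comp 3)))))
    encode-const-comp

  decode-index : ∀ σ n i → let p = pair n (pair (encode σ) i) in
                 decode (index p) ≡ comp (diagonal-program σ) (const-code p)
  decode-index σ n i = trans (cong decode index≡) (decode-encode _)
    where
      p : ℕ
      p = pair n (pair (encode σ) i)
      index≡ : index p ≡ encode (comp (diagonal-program σ) (const-code p))
      index≡ = begin
        index p
          ≡⟨ cong (λ j → #comp (diagonal-number j) (encode (const-code p))) (trans (cong L (R-pair n _)) (L-pair _ i)) ⟩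
        #comp (diagonal-number (encode σ)) (encode (const-code p))
          ≡⟨ cong (λ x → #comp x (encode (const-code p))) (sym (encode-diagonal σ)) ⟩
        #comp (encode (diagonal-program σ)) (encode (const-code p))
          ≡⟨ sym (encode-comp (diagonal-program σ) (const-code p)) ⟩
        encode (comp (diagonal-program σ) (const-code p))
          ∎
        where open ≡-Reasoning

  index-halts : ∀ σ n s y → Eval ∅ σ n s → y ∈ᶠ s →
    let i = rank s y ; p = pair n (pair (encode σ) i) in
    φ (index p) (index p) (component i (g n) (component (encode σ) (suc n) y))
  index-halts σ n s y σ-at-n y∈s =
      subst (λ c → Eval ∅ c (index p) v) (sym (decode-index σ n i))
            (ev-comp (const-code-ok p (index p)) program-halts)
    where
      i j p v : ℕ
      i = rank s y
      j = encode σ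
      p = pair n (pair j i)
      v = component i (g n) (component j (suc n) y)
      -- the chooser's search can only find y itself, so the output is v
      output-is-v : ∀ y′ → selection (stage-input n j i s y′) ≡ 0 → output (stage-input n j i s y′) ≡ v
      output-is-v y′ sel≡0 =
        let (y′∈s , same-rank) = select≡0 s i y′ (trans (sym (selection-at n j i s y′)) sel≡0)
        in trans (output-at n j i s y′)
                 (cong (λ x → component i (g n) (component j (suc n) x)) (rank-injective s y′ y y′∈s y∈s same-rank))
      program-halts : Eval ∅ (diagonal-program σ) p v
      program-halts =
        let (y′ , searched , sel≡0) = rfind-halts selection-comp (pair p s) y
                                        (trans (selection-at n j i s y) (select-rank s y y∈s))
        in ev-comp (ev-comp (ev-pair (ev-ident p) (ev-comp (ev-left p) σ-at-Lp)) (ev-pair (ev-ident _) searched))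
                   (subst (Eval ∅ _ _) (output-is-v y′ sel≡0) (proj₂ output-comp _))
        where
          σ-at-Lp : Eval ∅ σ (L p) s
          σ-at-Lp = subst (λ x → Eval ∅ σ x s) (sym (L-pair n (pair j i))) σ-at-n

-- Relative to a DNR function h ≤T A, the values h (index ⟨n , ⟨j , i⟩⟩)
-- (j ≤ n, i < g n) form a function diagonal-values ≤T A that no trace of size g
-- traces: for n ≥ encode σ in D, the component of diagonal-values n picked by
-- its rank in σ(n) is what index ⟨n , ⟨encode σ , rank⟩⟩ computes on itself.
module Untraceable (A : ℕ → Bool) (g : ℕ → ℕ) (g-computable : Computable g)
                   (h : ℕ → ℕ) (h≤A : h ≤T A) where
  open Diagonal g g-computable

  row : ℕ → ℕ
  row a = tuple (λ i → h (index (pair (L a) (pair (R a) i)))) (g (L a))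

  diagonal-values : ℕ → ℕ
  diagonal-values n = tuple (λ j → row (pair n j)) (suc n)

  diagonal-values≤A : diagonal-values ≤T A
  diagonal-values≤A = app₂ {H = λ n m → tuple (λ j → row (pair n j)) m}
    (tuple-comp {F = λ n j → row (pair n j)} (∘-comp row-comp (pair-comp L-comp R-comp))) id-comp suc-comp
    where
      row-comp : Comp (χ A) row
      row-comp = app₂ {H = λ a m → tuple (λ i → h (index (pair (L a) (pair (R a) i)))) m}
        (tuple-comp {F = λ a i → h (index (pair (L a) (pair (R a) i)))}
          (∘-comp h≤A (∘-comp index-comp (pair-comp LL-comp (pair-comp RL-comp R-comp)))))
        id-comp (∘-comp (computable⇒comp g-computable) L-comp)

  row-at : ∀ n j → row (pair n j) ≡ tuple (λ i → h (index (pair n (pair j i)))) (g n)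
  row-at n j rewrite unpair-pair n j = refl

  diagonal-values-component : ∀ n j i → j ≤ n → i < g n →
    component i (g n) (component j (suc n) (diagonal-values n)) ≡ h (index (pair n (pair j i)))
  diagonal-values-component n j i j≤n i<gn = begin
    component i (g n) (component j (suc n) (diagonal-values n))
      ≡⟨ cong (component i (g n)) (component-tuple (λ j → row (pair n j)) (suc n) j (s≤s j≤n)) ⟩
    component i (g n) (row (pair n j))
      ≡⟨ cong (component i (g n)) (row-at n j) ⟩
    component i (g n) (tuple (λ i → h (index (pair n (pair j i)))) (g n))
      ≡⟨ component-tuple (λ i → h (index (pair n (pair j i)))) (g n) i i<gn ⟩
    h (index (pair n (pair j i)))
      ∎
    where open ≡-Reasoning

  untraceable : (∀ e y → φ e e y → h e ≢ y) → ¬ Traceable g diagonal-values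
  untraceable dnr (d , inf , σ , trace , N , traced) =
      dnr (index p) v (index-halts σ n s y σ-at-n y∈s) (sym v≡h)
    where
      n-in-D : Σ ℕ λ n → N ⊔ encode σ ≤ n × W d n
      n-in-D = inf (N ⊔ encode σ)
      n : ℕ
      n = proj₁ n-in-D
      N⊔j≤n : N ⊔ encode σ ≤ n
      N⊔j≤n = proj₁ (proj₂ n-in-D)
      n∈D : W d n
      n∈D = proj₂ (proj₂ n-in-D)
      s y i p v : ℕ
      s = proj₁ (trace n n∈D)
      y = diagonal-values n
      i = rank s y
      p = pair n (pair (encode σ) i)
      v = component i (g n) (component (encode σ) (suc n) y)
      σ-at-n : Eval ∅ σ n s
      σ-at-n = proj₁ (proj₂ (trace n n∈D))
      y∈s : y ∈ᶠ s
      y∈s = traced n (≤-trans (m≤m⊔n N (encode σ)) N⊔j≤n) n∈D s σ-at-n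
      i<gn : i < g n
      i<gn = <-trans (rank<card s y y∈s) (proj₂ (proj₂ (trace n n∈D)))
      v≡h : v ≡ h (index p)
      v≡h = diagonal-values-component n (encode σ) i (≤-trans (m≤n⊔m N (encode σ)) N⊔j≤n) i<gn

traceable⇒not-DNR : ∀ A g → Computable g → (∀ f → f ≤T A → Traceable g f) → ¬ DNR A
traceable⇒not-DNR A g g-computable traceable (h , h≤A , dnr) =
  untraceable dnr (traceable diagonal-values diagonal-values≤A)
  where open Untraceable A g g-computable h h≤A

proposition10 : (A : ℕ → Bool) →
    (Σ (ℕ → ℕ) λ g → Computable g × Dominates g (λ n → n) ×
      (∀ f → f ≤T A → Σ Code λ d → Infinite (W d) ×
        Σ Code λ σ → IsTrace d g σ × Traces d σ f)) →
    HyperimmuneFree A × ¬ DNR A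
proposition10 A (g , g-computable , _ , traceable) =
  traceable⇒hyperimmune-free A g traceable , traceable⇒not-DNR A g g-computable traceable
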